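{- Let $X,Y\subseteq\mathbb{N}_0^d$ be finite down-sets, and let $A\subseteq X$, $B\subseteq Y$ be arbitrary subsets (not necessarily down-sets). Then \[ |A+B| \geq 2^d\min(|A|,|B|) - \sum_{I\subsetneq\{1,\dots,d\}} |\pi_I(X+Y)|. \]
   Context: $\mathbb{N}_0=\{0,1,2,\dots\}$. A set $S\subseteq\mathbb{N}_0^d$ is an $i$-down-set ($1\le i\le d$) if whenever $(x_1,\dots,x_d)\in S$, also $(x_1,\dots,x_{i-1},y_i,x_{i+1},\dots,x_d)\in S$ for all integers $0\le y_i\le x_i$; $S$ is a down-set if it is an $i$-down-set for every $1\le i\le d$. For $I\subseteq\{1,\dots,d\}$, $\pi_I:\mathbb{R}^d\to\mathbb{R}^d$ is the orthogonal projection $\pi_I(\sum_{i=1}^d x_ie_i):=\sum_{i\in I}x_ie_i$, where $e_1,\dots,e_d$ is the standard basis. Sumsets are Minkowski sums $X+Y:=\{x+y:x\in X,y\in Y\}$. -}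

module Defs where

open import Data.Nat using (ℕ; zero; suc; _+_; _≤_; _≟_)
open import Data.Bool using (Bool; true; false; if_then_else_)
open import Data.Fin using (Fin)
open import Data.Vec using (Vec; []; _∷_; lookup; zipWith; _[_]≔_; replicate)
open import Data.Vec.Properties using (≡-dec)
open import Data.List using (List; []; _∷_; map; concatMap; length; deduplicate; filter)
open import Data.Nat.ListAction using (sum)
open import Data.List.Membership.Propositional using (_∈_)
open import Relation.Binary.PropositionalEquality using (_≡_)
open import Relation.Binary.Definitions using (DecidableEquality)
open import Relation.Nullary using (¬_)
open import Relation.Nullary.Decidable using (¬?)

Pt : ℕ → Set
Pt d = Vec ℕ d

_≟ᵖ_ : ∀ {d} → DecidableEquality (Pt d)
_≟ᵖ_ = ≡-dec _≟_

-- Finite subsets of ℕ₀^d are represented by lists (duplicates allowed);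
-- the cardinality of the represented set counts distinct elements.
card : ∀ {d} → List (Pt d) → ℕ
card S = length (deduplicate _≟ᵖ_ S)

_⊆ˢ_ : ∀ {d} → List (Pt d) → List (Pt d) → Set
S ⊆ˢ T = ∀ x → x ∈ S → x ∈ T

IsIDownSet : ∀ {d} → Fin d → List (Pt d) → Set
IsIDownSet i S = ∀ x → x ∈ S → ∀ y → y ≤ lookup x i → (x [ i ]≔ y) ∈ S

IsDownSet : ∀ {d} → List (Pt d) → Set
IsDownSet {d} S = ∀ (i : Fin d) → IsIDownSet i S

_⊕_ : ∀ {d} → List (Pt d) → List (Pt d) → List (Pt d)
X ⊕ Y = concatMap (λ x → map (zipWith _+_ x) Y) X

-- Index subsets I ⊆ {1,…,d} as characteristic vectors
IdxSet : ℕ → Set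
IdxSet d = Vec Bool d

allIdxSets : (d : ℕ) → List (IdxSet d)
allIdxSets zero = [] ∷ []
allIdxSets (suc d) = map (true ∷_) (allIdxSets d) Data.List.++ map (false ∷_) (allIdxSets d)

fullIdx : (d : ℕ) → IdxSet d
fullIdx d = replicate d true

properIdxSets : (d : ℕ) → List (IdxSet d)
properIdxSets d = filter (λ I → ¬? (≡-dec Data.Bool._≟_ I (fullIdx d))) (allIdxSets d)

π : ∀ {d} → IdxSet d → Pt d → Pt d
π I x = zipWith (λ b xi → if b then xi else 0) I x

πˢ : ∀ {d} → IdxSet d → List (Pt d) → List (Pt d)
πˢ I S = map (π I) S

projSum : (d : ℕ) → List (Pt d) → ℕ
projSum d S = sum (map (λ I → card (πˢ I S)) (properIdxSets d))

-- For finite S ⊆ ℕ^d let Φ(S) = Σ_{I ⊆ [d]} |π_I(S)|. We show 4^d |A| |B| ≤ Φ(A + B)²; as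
-- min(|A|,|B|)² ≤ |A| |B|, π_[d] is the identity and π_I(A + B) ⊆ π_I(X + Y), this gives the
-- theorem.
--
-- The inequality is proved by induction on d, slicing along the first coordinate:
-- Φ(S) = Φ(S′) + Σ_h Φ(S_h), where S′ is the projection along that coordinate and S_h the
-- fibre over h. Put a_k = |A_k|, b_l = |B_l|, α = max a, β = max b. A weighted
-- Cauchy–Davenport inequality in ℕ, reduced by a layer-cake argument to |K| + |L| ≤ |K + L| + 1,
-- gives β|A| + α|B| ≤ αβ + Σ_h w_h with w_h = max_{k+l=h} min(β a_k, α b_l). The induction
-- hypotheses give 2^d √(αβ) ≤ Φ(S′), since α ≤ |A′| and β ≤ |B′|, and 2^d w_h ≤ √(αβ) Φ(S_h),
-- since A_k + B_l ⊆ S_{k+l}. Summing, and using 2 √(αβ |A| |B|) ≤ β|A| + α|B|, gives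
-- 2^{d+1} √(|A| |B|) ≤ Φ(S).

module Submission where

open import Defs
open import Algebra.Properties.CommutativeSemigroup using (interchange)
open import Data.Bool using (Bool; true; false; T; _∧_; _∨_; not; if_then_else_)
import Data.Bool
open import Data.Bool.Properties using (∧-identityʳ; ∧-zeroʳ; T-≡)
open import Data.Empty using (⊥-elim)
open import Data.List using (List; []; _∷_; map; filter; length; cartesianProductWith; _++_)
open import Data.List.Membership.Propositional using (_∈_)
open import Data.List.Membership.Propositional.Properties
  using (∈-map⁺; ∈-map⁻; ∈-filter⁺; ∈-filter⁻; ∈-deduplicate⁺; ∈-deduplicate⁻;
         ∈-cartesianProductWith⁺; ∈-cartesianProductWith⁻; ∈-++⁺ˡ; ∈-++⁺ʳ)
open import Data.List.Properties using (map-cong; map-id; map-++; map-∘; filter-++)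
import Data.List.Relation.Unary.All as List
open import Data.List.Relation.Unary.AllPairs using ([]; _∷_)
open import Data.List.Relation.Unary.Any using (any?; here; there)
open import Data.List.Relation.Unary.Unique.Propositional using (Unique)
open import Data.List.Relation.Unary.Unique.DecPropositional.Properties using (deduplicate-!)
open import Data.Nat hiding (_≥_)
open import Data.Nat.ListAction using (sum)
open import Data.Nat.ListAction.Properties using (sum-++)
open import Data.Nat.Properties
open import Data.Nat.Tactic.RingSolver using (solve-∀)
open import Data.Product using (∃; ∃₂; _×_; _,_)
open import Data.Sum using (inj₁; inj₂)
open import Data.Unit using (tt)
open import Data.Vec using ([]; _∷_; zipWith; head; tail)
import Data.Vec as Vec
open import Data.Vec.Properties using (≡-dec)
import Data.Vec.Relation.Unary.All as Vec
open import Function using (_∘_; id)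
open import Function.Bundles using (Equivalence)
open import Relation.Binary.PropositionalEquality
open import Relation.Nullary using (¬_; yes; no; does; ¬?)

+-interchange : ∀ w x y z → (w + x) + (y + z) ≡ (w + y) + (x + z)
+-interchange = interchange +-commutativeSemigroup

∑ : ℕ → (ℕ → ℕ) → ℕ
∑ zero    f = 0
∑ (suc n) f = ∑ n f + f n

module _ {f g : ℕ → ℕ} where

  ∑-cong : ∀ n → (∀ {i} → i < n → f i ≡ g i) → ∑ n f ≡ ∑ n g
  ∑-cong zero    eq = refl
  ∑-cong (suc n) eq = cong₂ _+_ (∑-cong n (eq ∘ m<n⇒m<1+n)) (eq ≤-refl)

  ∑-mono-≤ : ∀ n → (∀ {i} → i < n → f i ≤ g i) → ∑ n f ≤ ∑ n g
  ∑-mono-≤ zero    le = z≤n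
  ∑-mono-≤ (suc n) le = +-mono-≤ (∑-mono-≤ n (le ∘ m<n⇒m<1+n)) (le ≤-refl)

  ∑-distrib-+ : ∀ n → ∑ n (λ i → f i + g i) ≡ ∑ n f + ∑ n g
  ∑-distrib-+ zero    = refl
  ∑-distrib-+ (suc n) = trans (cong (_+ (f n + g n)) (∑-distrib-+ n)) (+-interchange (∑ n f) (∑ n g) (f n) (g n))

  ∑-suc-at : ∀ n {j} → j < n → (∀ {i} → i < n → i ≢ j → f i ≡ g i) → f j ≡ suc (g j) →
             ∑ n f ≡ suc (∑ n g)
  ∑-suc-at (suc n) j<1+n eq eqⱼ with m<1+n⇒m<n∨m≡n j<1+n
  ... | inj₁ j<n = begin
    ∑ n f + f n       ≡⟨ cong₂ _+_ (∑-suc-at n j<n (eq ∘ m<n⇒m<1+n) eqⱼ) (eq ≤-refl (<⇒≢ j<n ∘ sym)) ⟩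
    suc (∑ n g) + g n ∎
    where open ≡-Reasoning
  ... | inj₂ refl = begin
    ∑ n f + f n             ≡⟨ cong₂ _+_ (∑-cong n (λ i<n → eq (m<n⇒m<1+n i<n) (<⇒≢ i<n))) eqⱼ ⟩
    ∑ n g + suc (g n)       ≡⟨ +-suc (∑ n g) (g n) ⟩
    suc (∑ n g + g n)       ∎
    where open ≡-Reasoning

∑-distribˡ-* : ∀ n c (f : ℕ → ℕ) → ∑ n (λ i → c * f i) ≡ c * ∑ n f
∑-distribˡ-* zero    c f = sym (*-zeroʳ c)
∑-distribˡ-* (suc n) c f = trans (cong (_+ c * f n) (∑-distribˡ-* n c f)) (sym (*-distribˡ-+ c (∑ n f) (f n)))

∑-zero : ∀ n → ∑ n (λ _ → 0) ≡ 0
∑-zero zero    = refl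
∑-zero (suc n) = trans (+-identityʳ _) (∑-zero n)

∑-concentrated : ∀ n (f : ℕ → ℕ) → (∀ {i} → i < suc n → 0 < i → f i ≡ 0) → ∑ (suc n) f ≡ f 0
∑-concentrated zero    f zeros = refl
∑-concentrated (suc n) f zeros =
  trans (cong₂ _+_ (∑-concentrated n f (zeros ∘ m<n⇒m<1+n)) (zeros ≤-refl z<s)) (+-identityʳ (f 0))

term≤∑ : ∀ n (f : ℕ → ℕ) {i} → i < n → f i ≤ ∑ n f
term≤∑ (suc n) f i<1+n with m<1+n⇒m<n∨m≡n i<1+n
... | inj₁ i<n  = ≤-trans (term≤∑ n f i<n) (m≤m+n (∑ n f) (f n))
... | inj₂ refl = m≤n+m (f n) (∑ n f)

𝟙 : Bool → ℕ
𝟙 b = if b then 1 else 0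

count : ℕ → (ℕ → Bool) → ℕ
count n P = ∑ n (𝟙 ∘ P)

_∖_ : (ℕ → Bool) → ℕ → (ℕ → Bool)
(P ∖ k) i = P i ∧ not (i ≡ᵇ k)

≡ᵇ-false : ∀ {i k} → i ≢ k → (i ≡ᵇ k) ≡ false
≡ᵇ-false {i} {k} i≢k with i ≡ᵇ k in eq
... | true  = ⊥-elim (i≢k (≡ᵇ⇒≡ i k (subst T (sym eq) tt)))
... | false = refl

≡ᵇ-refl : ∀ k → (k ≡ᵇ k) ≡ true
≡ᵇ-refl k = Equivalence.to T-≡ (≡⇒≡ᵇ k k refl)

module _ (P : ℕ → Bool) where

  ∈-∖⁺ : ∀ {i k} → T (P i) → i ≢ k → T ((P ∖ k) i)
  ∈-∖⁺ {i} Pi i≢k rewrite ≡ᵇ-false i≢k | ∧-identityʳ (P i) = Pi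

  ∈-∖⁻ : ∀ {i k} → T ((P ∖ k) i) → T (P i) × i ≢ k
  ∈-∖⁻ {i} {k} Pi with P i | i ≡ᵇ k in eq
  ... | true | false = tt , λ i≡k → subst T eq (≡⇒≡ᵇ i k i≡k)

  count-pos : ∀ n {k} → k < n → T (P k) → 0 < count n P
  count-pos n k<n Pk = ≤-trans (𝟙-T Pk) (term≤∑ n (𝟙 ∘ P) k<n)
    where
    𝟙-T : ∀ {b} → T b → 0 < 𝟙 b
    𝟙-T {true} _ = z<s

  count-∖ : ∀ n {k} → k < n → T (P k) → count n P ≡ suc (count n (P ∖ k))
  count-∖ n {k} k<n Pk = ∑-suc-at n k<n unchanged removed
    where
    unchanged : ∀ {i} → i < n → i ≢ k → 𝟙 (P i) ≡ 𝟙 ((P ∖ k) i)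
    unchanged {i} _ i≢k rewrite ≡ᵇ-false i≢k = cong 𝟙 (sym (∧-identityʳ (P i)))
    removed : 𝟙 (P k) ≡ suc (𝟙 ((P ∖ k) k))
    removed rewrite ≡ᵇ-refl k | ∧-zeroʳ (P k) with P k
    ... | true = refl

  lastElement : ∀ n → 0 < count n P →
                ∃ λ k → k < n × T (P k) × (∀ {i} → i < n → T (P i) → i ≤ k)
  lastElement (suc n) pos with P n in Pn
  ... | true  = n , ≤-refl , subst T (sym Pn) tt , λ i<1+n _ → m<1+n⇒m≤n i<1+n
  ... | false with lastElement n (subst (0 <_) (+-identityʳ (count n P)) pos)
  ...   | k , k<n , Pk , top = k , m<n⇒m<1+n k<n , Pk , top′
    where
    top′ : ∀ {i} → i < suc n → T (P i) → i ≤ k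
    top′ i<1+n Pi with m<1+n⇒m<n∨m≡n i<1+n
    ... | inj₁ i<n  = top i<n Pi
    ... | inj₂ refl = ⊥-elim (subst T Pn Pi)

-- Cauchy–Davenport in ℕ

module _ {n : ℕ} where

  SumsInto : (ℕ → Bool) → (ℕ → Bool) → (ℕ → Bool) → Set
  SumsInto K L W = ∀ {k l} → k < n → l < n → T (K k) → T (L l) → k + l < n × T (W (k + l))

  sumsInto-swap : ∀ K L W → SumsInto K L W → SumsInto L K W
  sumsInto-swap K L W sums {l} {k} l<n k<n Ll Kk with sums k<n l<n Kk Ll
  ... | k+l<n , Wk+l rewrite +-comm k l = k+l<n , Wk+l

  -- The largest sum k + l of the two largest elements is a sum of no other pair,
  -- so it can be removed from W together with k from K.
  dropLargest : ∀ K L W → SumsInto K L W → 1 < count n K → 0 < count n L →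
                ∃₂ λ K′ W′ → SumsInto K′ L W′ × count n K ≡ suc (count n K′) × count n W ≡ suc (count n W′)
  dropLargest K L W sums 1<|K| 0<|L|
    with lastElement K n (<-trans z<s 1<|K|) | lastElement L n 0<|L|
  ... | k , k<n , Kk , kTop | l , l<n , Ll , lTop with sums k<n l<n Kk Ll
  ...   | k+l<n , Wk+l = K ∖ k , W ∖ (k + l) , sums′ , count-∖ K n k<n Kk , count-∖ W n k+l<n Wk+l
    where
    sums′ : SumsInto (K ∖ k) L (W ∖ (k + l))
    sums′ {k′} {l′} k′<n l′<n K′k′ Ll′ with ∈-∖⁻ K K′k′
    ... | Kk′ , k′≢k with sums k′<n l′<n Kk′ Ll′
    ...   | k′+l′<n , Wk′+l′ = k′+l′<n , ∈-∖⁺ W Wk′+l′ (<⇒≢ (+-mono-<-≤ (≤∧≢⇒< (kTop k′<n Kk′) k′≢k) (lTop l′<n Ll′)))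

  cauchyDavenport′ : ∀ t K L W → SumsInto K L W → 0 < count n K → 0 < count n L →
                     count n K + count n L ≤ t → count n K + count n L ≤ suc (count n W)
  cauchyDavenport′ zero _ _ _ _ 0<|K| _ |K|+|L|≤0 = ⊥-elim (<⇒≱ (<-≤-trans 0<|K| (m≤m+n _ _)) |K|+|L|≤0)
  cauchyDavenport′ (suc t) K L W sums 0<|K| 0<|L| |K|+|L|≤1+t
    with 1 <? count n K | 1 <? count n L
  ... | yes 1<|K| | _ =
    let K′ , W′ , sums′ , |K|≡ , |W|≡ = dropLargest K L W sums 1<|K| 0<|L|
        0<|K′| = ≤-pred (subst (1 <_) |K|≡ 1<|K|)
        bound = ≤-pred (subst (λ c → c + count n L ≤ suc t) |K|≡ |K|+|L|≤1+t)
    in subst₂ _≤_ (cong (_+ count n L) (sym |K|≡)) (cong suc (sym |W|≡))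
         (s≤s (cauchyDavenport′ t K′ L W′ sums′ 0<|K′| 0<|L| bound))
  ... | no _ | yes 1<|L| =
    let L′ , W′ , sums′ , |L|≡ , |W|≡ = dropLargest L K W (sumsInto-swap K L W sums) 1<|L| 0<|K|
        0<|L′| = ≤-pred (subst (1 <_) |L|≡ 1<|L|)
        |K|+|L|≡ = trans (cong (count n K +_) |L|≡) (+-suc (count n K) (count n L′))
        bound = ≤-pred (subst (_≤ suc t) |K|+|L|≡ |K|+|L|≤1+t)
    in subst₂ _≤_ (sym |K|+|L|≡) (cong suc (sym |W|≡))
         (s≤s (cauchyDavenport′ t K L′ W′ (sumsInto-swap L′ K W′ sums′) 0<|K| 0<|L′| bound))
  ... | no 1≮|K| | no 1≮|L| =
    let k , k<n , Kk , _ = lastElement K n 0<|K|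
        l , l<n , Ll , _ = lastElement L n 0<|L|
        k+l<n , Wk+l = sums k<n l<n Kk Ll
    in +-mono-≤ (≮⇒≥ 1≮|K|) (≤-trans (≮⇒≥ 1≮|L|) (count-pos W n k+l<n Wk+l))

  cauchyDavenport : ∀ K L W → SumsInto K L W → 0 < count n K → 0 < count n L →
                    count n K + count n L ≤ suc (count n W)
  cauchyDavenport K L W sums 0<|K| 0<|L| = cauchyDavenport′ _ K L W sums 0<|K| 0<|L| ≤-refl

positive : (ℕ → ℕ) → ℕ → Bool
positive x i = 0 <ᵇ x i

∑-layer : ∀ n (x : ℕ → ℕ) → ∑ n x ≡ ∑ n (λ i → x i ∸ 1) + count n (positive x)
∑-layer n x = trans (∑-cong n (λ {i} _ → peel (x i))) (∑-distrib-+ n)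
  where
  peel : ∀ m → m ≡ m ∸ 1 + 𝟙 (0 <ᵇ m)
  peel zero    = refl
  peel (suc m) = +-comm 1 m

-- Layer-cake reduction to `cauchyDavenport`: the level sets {x > t}, {y > t}, {w > t}
-- satisfy its hypotheses for every t < M.
weightedCauchyDavenport : ∀ M n (x y w : ℕ → ℕ) →
  (∀ {k} → k < n → x k ≤ M) → (∀ {l} → l < n → y l ≤ M) →
  (∃ λ k → k < n × x k ≡ M) → (∃ λ l → l < n × y l ≡ M) →
  (∀ {k l} → k < n → l < n → 0 < x k → 0 < y l → k + l < n) →
  (∀ {k l} → k + l < n → x k ⊓ y l ≤ w (k + l)) →
  ∑ n x + ∑ n y ≤ ∑ n w + M
weightedCauchyDavenport zero n x y w x≤0 y≤0 _ _ _ _ = begin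
  ∑ n x + ∑ n y                   ≡⟨ cong₂ _+_ (∑-cong n (n≤0⇒n≡0 ∘ x≤0)) (∑-cong n (n≤0⇒n≡0 ∘ y≤0)) ⟩
  ∑ n (λ _ → 0) + ∑ n (λ _ → 0)   ≡⟨ cong₂ _+_ (∑-zero n) (∑-zero n) ⟩
  0                               ≤⟨ z≤n ⟩
  ∑ n w + 0                       ∎
  where open ≤-Reasoning
weightedCauchyDavenport (suc M) n x y w x≤M y≤M (k₀ , k₀<n , xk₀≡M) (l₀ , l₀<n , yl₀≡M) supp w≥ = begin
  ∑ n x + ∑ n y                             ≡⟨ cong₂ _+_ (∑-layer n x) (∑-layer n y) ⟩
  (∑ n x′ + count n X) + (∑ n y′ + count n Y) ≡⟨ +-interchange (∑ n x′) (count n X) (∑ n y′) (count n Y) ⟩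
  (∑ n x′ + ∑ n y′) + (count n X + count n Y) ≤⟨ +-mono-≤ lower upper ⟩
  (∑ n w′ + M) + suc (count n W)              ≡⟨ rearrange (∑ n w′) M (count n W) ⟩
  (∑ n w′ + count n W) + suc M               ≡⟨ cong (_+ suc M) (∑-layer n w) ⟨
  ∑ n w + suc M                             ∎
  where
  open ≤-Reasoning
  x′ y′ w′ : ℕ → ℕ
  x′ i = x i ∸ 1
  y′ i = y i ∸ 1
  w′ i = w i ∸ 1
  X Y W : ℕ → Bool
  X = positive x
  Y = positive y
  W = positive w
  rearrange : ∀ a m c → (a + m) + suc c ≡ (a + c) + suc m
  rearrange = solve-∀
  lower : ∑ n x′ + ∑ n y′ ≤ ∑ n w′ + M
  lower = weightedCauchyDavenport M n x′ y′ w′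
    (∸-monoˡ-≤ 1 ∘ x≤M) (∸-monoˡ-≤ 1 ∘ y≤M)
    (k₀ , k₀<n , cong (_∸ 1) xk₀≡M) (l₀ , l₀<n , cong (_∸ 1) yl₀≡M)
    (λ k<n l<n 0<x′k 0<y′l → supp k<n l<n (<-≤-trans 0<x′k (m∸n≤m _ 1)) (<-≤-trans 0<y′l (m∸n≤m _ 1)))
    (λ {k} {l} k+l<n → subst (_≤ w′ (k + l)) (∸-distribʳ-⊓ 1 (x k) (y l)) (∸-monoˡ-≤ 1 (w≥ k+l<n)))
  sums : SumsInto {n} X Y W
  sums {k} {l} k<n l<n Xk Yl = k+l<n , <⇒<ᵇ (<-≤-trans (⊓-pres-pos 0<xk 0<yl) (w≥ k+l<n))
    where
    0<xk = <ᵇ⇒< 0 (x k) Xk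
    0<yl = <ᵇ⇒< 0 (y l) Yl
    k+l<n = supp k<n l<n 0<xk 0<yl
    ⊓-pres-pos : ∀ {a b} → 0 < a → 0 < b → 0 < a ⊓ b
    ⊓-pres-pos {suc a} {suc b} _ _ = z<s
  upper : count n X + count n Y ≤ suc (count n W)
  upper = cauchyDavenport X Y W sums
    (count-pos X n k₀<n (<⇒<ᵇ (subst (0 <_) (sym xk₀≡M) z<s)))
    (count-pos Y n l₀<n (<⇒<ᵇ (subst (0 <_) (sym yl₀≡M) z<s)))

-- The numerical induction step

max< : ℕ → (ℕ → ℕ) → ℕ
max< zero    f = 0
max< (suc n) f = max< n f ⊔ f n

module _ (f : ℕ → ℕ) where

  max<-upper : ∀ n {i} → i < n → f i ≤ max< n f
  max<-upper (suc n) i<1+n with m<1+n⇒m<n∨m≡n i<1+n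
  ... | inj₁ i<n  = ≤-trans (max<-upper n i<n) (m≤m⊔n _ _)
  ... | inj₂ refl = m≤n⊔m _ _

  max<-attained : ∀ n → ∃ λ i → i < suc n × f i ≡ max< (suc n) f
  max<-attained zero    = 0 , z<s , refl
  max<-attained (suc n) with ⊔-sel (max< (suc n) f) (f (suc n))
  ... | inj₂ eq = suc n , ≤-refl , sym eq
  ... | inj₁ eq = let i , i<1+n , fi≡ = max<-attained n in i , m<n⇒m<1+n i<1+n , trans fi≡ (sym eq)

  max<-attained-pos : ∀ n → 0 < max< n f → ∃ λ i → i < n × f i ≡ max< n f
  max<-attained-pos (suc n) _ = max<-attained n

  max<-lub : ∀ n {b} → (∀ {i} → i < n → f i ≤ b) → max< n f ≤ b
  max<-lub zero    _  = z≤n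
  max<-lub (suc n) le = ⊔-lub (max<-lub n (le ∘ m<n⇒m<1+n)) (le ≤-refl)

square-≤⇒≤ : ∀ {m n} → m * m ≤ n * n → m ≤ n
square-≤⇒≤ {m} {n} m²≤n² with m ≤? n
... | yes m≤n = m≤n
... | no  m≰n = ⊥-elim (<⇒≱ (*-mono-< (≰⇒> m≰n) (≰⇒> m≰n)) m²≤n²)

4*m*n≤[m+n]²-≤ : ∀ {m n} → m ≤ n → 4 * (m * n) ≤ (m + n) * (m + n)
4*m*n≤[m+n]²-≤ {m} m≤n = subst (λ k → 4 * (m * k) ≤ (m + k) * (m + k)) (m+[n∸m]≡n m≤n) (gap m _)
  where
  expand : ∀ m r → 4 * (m * (m + r)) + r * r ≡ (m + (m + r)) * (m + (m + r))
  expand = solve-∀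
  gap : ∀ m r → 4 * (m * (m + r)) ≤ (m + (m + r)) * (m + (m + r))
  gap m r = subst (4 * (m * (m + r)) ≤_) (expand m r) (m≤m+n _ (r * r))

4*m*n≤[m+n]² : ∀ m n → 4 * (m * n) ≤ (m + n) * (m + n)
4*m*n≤[m+n]² m n with ≤-total m n
... | inj₁ m≤n = 4*m*n≤[m+n]²-≤ m≤n
... | inj₂ n≤m = subst₂ _≤_ (cong (4 *_) (*-comm n m)) (cong₂ _*_ (+-comm n m) (+-comm n m)) (4*m*n≤[m+n]²-≤ n≤m)

4^n≡2^n*2^n : ∀ n → 4 ^ n ≡ 2 ^ n * 2 ^ n
4^n≡2^n*2^n zero    = refl
4^n≡2^n*2^n (suc n) = trans (cong (4 *_) (4^n≡2^n*2^n n)) (regroup (2 ^ n))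
  where
  regroup : ∀ t → 4 * (t * t) ≡ 2 * t * (2 * t)
  regroup = solve-∀

infix 4 _√_≤_√_

-- q √ c ≤ p √ m stands for q √c ≤ p √m, squared so as to stay in ℕ.
record _√_≤_√_ (q c p m : ℕ) : Set where
  constructor squared
  field unsquare : c * (q * q) ≤ m * (p * p)

open _√_≤_√_

√-+ : ∀ {c m q q′ p p′} → q √ c ≤ p √ m → q′ √ c ≤ p′ √ m → q + q′ √ c ≤ p + p′ √ m
√-+ {c} {m} {q} {q′} {p} {p′} (squared le) (squared le′) = squared (begin
  c * ((q + q′) * (q + q′))                       ≡⟨ expandˡ c q q′ ⟩
  c * (q * q) + 2 * (c * q * q′) + c * (q′ * q′)  ≤⟨ +-mono-≤ (+-mono-≤ le (*-monoʳ-≤ 2 cross)) le′ ⟩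
  m * (p * p) + 2 * (m * p * p′) + m * (p′ * p′)  ≡⟨ expandˡ m p p′ ⟨
  m * ((p + p′) * (p + p′))                       ∎)
  where
  open ≤-Reasoning
  expandˡ : ∀ a x y → a * ((x + y) * (x + y)) ≡ a * (x * x) + 2 * (a * x * y) + a * (y * y)
  expandˡ = solve-∀
  square-product : ∀ a x y → (a * x * y) * (a * x * y) ≡ (a * (x * x)) * (a * (y * y))
  square-product = solve-∀
  cross : c * q * q′ ≤ m * p * p′
  cross = square-≤⇒≤ (subst₂ _≤_ (sym (square-product c q q′)) (sym (square-product m p p′)) (*-mono-≤ le le′))

√-∑ : ∀ {c m} n {q p : ℕ → ℕ} → (∀ {h} → h < n → q h √ c ≤ p h √ m) → ∑ n q √ c ≤ ∑ n p √ m
√-∑ {c} {m} zero    _  = squared (≤-reflexive (trans (*-zeroʳ c) (sym (*-zeroʳ m))))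
√-∑         (suc n) le = √-+ (√-∑ n (le ∘ m<n⇒m<1+n)) (le ≤-refl)

0<m*n⇒0<n : ∀ m {n} → 0 < m * n → 0 < n
0<m*n⇒0<n m {zero}  0<m*0 = subst (0 <_) (*-zeroʳ m) 0<m*0
0<m*n⇒0<n m {suc n} _     = z<s

max<≡0⇒∑≡0 : ∀ n (f : ℕ → ℕ) → max< n f ≡ 0 → ∑ n f ≡ 0
max<≡0⇒∑≡0 n f max≡0 = trans (∑-cong n (λ i<n → n≤0⇒n≡0 (subst (f _ ≤_) max≡0 (max<-upper f n i<n)))) (∑-zero n)

maxMin : (ℕ → ℕ) → (ℕ → ℕ) → ℕ → ℕ
maxMin x y h = max< (suc h) (λ k → x k ⊓ y (h ∸ k))

maxMin-upper : ∀ (x y : ℕ → ℕ) k l → x k ⊓ y l ≤ maxMin x y (k + l)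
maxMin-upper x y k l = subst (λ j → x k ⊓ y j ≤ maxMin x y (k + l)) (m+n∸m≡n k l)
                             (max<-upper (λ i → x i ⊓ y (k + l ∸ i)) (suc (k + l)) (s≤s (m≤m+n k l)))

maxMin-attained : ∀ (x y : ℕ → ℕ) h → ∃₂ λ k l → k + l ≡ h × x k ⊓ y l ≡ maxMin x y h
maxMin-attained x y h =
  let k , k<1+h , xk⊓y[h-k]≡ = max<-attained (λ i → x i ⊓ y (h ∸ i)) h
  in k , h ∸ k , m+[n∸m]≡n (m<1+n⇒m≤n k<1+h) , xk⊓y[h-k]≡

-- With α = max a and β = max b, the sequences β·a and α·b are bounded by αβ and attain it.
linearBound : ∀ N {a b : ℕ → ℕ} {α β} → max< N a ≡ α → max< N b ≡ β → 0 < α → 0 < β →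
              (∀ {k l} → k < N → l < N → 0 < a k → 0 < b l → k + l < N) →
              β * ∑ N a + α * ∑ N b ≤ α * β + ∑ N (maxMin (λ k → β * a k) (λ l → α * b l))
linearBound N {a} {b} {α} {β} α≡ β≡ 0<α 0<β supp = begin
  β * ∑ N a + α * ∑ N b ≡⟨ cong₂ _+_ (∑-distribˡ-* N β a) (∑-distribˡ-* N α b) ⟨
  ∑ N x + ∑ N y         ≤⟨ weightedCauchyDavenport (α * β) N x y (maxMin x y) x≤ y≤ xAttains yAttains
                             (λ k<N l<N 0<xk 0<yl → supp k<N l<N (0<m*n⇒0<n β 0<xk) (0<m*n⇒0<n α 0<yl))
                             (λ {k} {l} _ → maxMin-upper x y k l) ⟩
  ∑ N w + α * β         ≡⟨ +-comm (∑ N w) (α * β) ⟩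
  α * β + ∑ N w         ∎
  where
  open ≤-Reasoning
  x y w : ℕ → ℕ
  x k = β * a k
  y l = α * b l
  w = maxMin x y
  x≤ : ∀ {k} → k < N → x k ≤ α * β
  x≤ k<N = ≤-trans (*-monoʳ-≤ β (subst (a _ ≤_) α≡ (max<-upper a N k<N))) (≤-reflexive (*-comm β α))
  y≤ : ∀ {l} → l < N → y l ≤ α * β
  y≤ l<N = *-monoʳ-≤ α (subst (b _ ≤_) β≡ (max<-upper b N l<N))
  xAttains : ∃ λ k → k < N × x k ≡ α * β
  xAttains = let k , k<N , ak≡ = max<-attained-pos a N (subst (0 <_) (sym α≡) 0<α)
             in k , k<N , trans (cong (β *_) (trans ak≡ α≡)) (*-comm β α)
  yAttains : ∃ λ l → l < N × y l ≡ α * β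
  yAttains = let l , l<N , bl≡ = max<-attained-pos b N (subst (0 <_) (sym β≡) 0<β)
             in l , l<N , cong (α *_) (trans bl≡ β≡)

fibreBound : ∀ {c} {a b u : ℕ → ℕ} α β → (∀ k l → c * (a k * b l) ≤ u (k + l) * u (k + l)) →
             ∀ h → maxMin (λ k → β * a k) (λ l → α * b l) h √ c ≤ u h √ (α * β)
fibreBound {c} {a} {b} {u} α β ih h with maxMin-attained (λ k → β * a k) (λ l → α * b l) h
... | k , l , refl , xk⊓yl≡ = squared (begin
  c * (w * w)                              ≡⟨ cong (λ v → c * (v * v)) xk⊓yl≡ ⟨
  c * (((β * a k) ⊓ (α * b l)) * ((β * a k) ⊓ (α * b l)))
                                           ≤⟨ *-monoʳ-≤ c (*-mono-≤ (m⊓n≤m (β * a k) (α * b l)) (m⊓n≤n (β * a k) (α * b l))) ⟩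
  c * ((β * a k) * (α * b l))              ≡⟨ regroup c (a k) (b l) α β ⟩
  α * β * (c * (a k * b l))                ≤⟨ *-monoʳ-≤ (α * β) (ih k l) ⟩
  α * β * (u (k + l) * u (k + l))          ∎)
  where
  open ≤-Reasoning
  w = maxMin (λ k → β * a k) (λ l → α * b l) (k + l)
  regroup : ∀ c a b α β → c * ((β * a) * (α * b)) ≡ α * β * (c * (a * b))
  regroup = solve-∀

-- The fibres A_k, B_l of A, B (with |A_k| = a k, |B_l| = b l) satisfy A_k + B_l ⊆ S_{k+l};
-- the hypotheses are the induction hypotheses for these fibres and for the shadows.
inductionStep : ∀ c N (a b u : ℕ → ℕ) (|A′| |B′| u₀ : ℕ) →
  (∀ k → a k ≤ |A′|) → (∀ l → b l ≤ |B′|) →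
  c * (|A′| * |B′|) ≤ u₀ * u₀ →
  (∀ k l → c * (a k * b l) ≤ u (k + l) * u (k + l)) →
  (∀ {k l} → k < N → l < N → 0 < a k → 0 < b l → k + l < N) →
  4 * c * (∑ N a * ∑ N b) ≤ (u₀ + ∑ N u) * (u₀ + ∑ N u)
inductionStep c N a b u |A′| |B′| u₀ a≤ b≤ ih₀ ih supp
  with max< N a in α≡ | max< N b in β≡
... | zero | _ rewrite max<≡0⇒∑≡0 N a α≡ | *-zeroʳ (4 * c) = z≤n
... | suc _ | zero rewrite max<≡0⇒∑≡0 N b β≡ | *-zeroʳ (∑ N a) | *-zeroʳ (4 * c) = z≤n
... | suc α′ | suc β′ = *-cancelˡ-≤ m (begin
  m * (4 * c * (∑ N a * ∑ N b))                            ≡⟨ regroup c (∑ N a) (∑ N b) α β ⟩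
  c * (4 * ((β * ∑ N a) * (α * ∑ N b)))                    ≤⟨ *-monoʳ-≤ c (4*m*n≤[m+n]² (β * ∑ N a) (α * ∑ N b)) ⟩
  c * ((β * ∑ N a + α * ∑ N b) * (β * ∑ N a + α * ∑ N b))  ≤⟨ *-monoʳ-≤ c (*-mono-≤ linear linear) ⟩
  c * ((m + ∑ N w) * (m + ∑ N w))                          ≤⟨ unsquare (√-+ shadowBound (√-∑ N (λ {h} _ → fibreBound {a = a} {b} {u} α β ih h))) ⟩
  m * ((u₀ + ∑ N u) * (u₀ + ∑ N u))                        ∎)
  where
  open ≤-Reasoning
  α β m : ℕ
  α = suc α′
  β = suc β′
  m = α * β
  w = maxMin (λ k → β * a k) (λ l → α * b l)
  regroup : ∀ c A B α β → α * β * (4 * c * (A * B)) ≡ c * (4 * ((β * A) * (α * B)))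
  regroup = solve-∀
  linear : β * ∑ N a + α * ∑ N b ≤ m + ∑ N w
  linear = linearBound N α≡ β≡ z<s z<s supp
  shadowBound : m √ c ≤ u₀ √ m
  shadowBound = squared (begin
    c * (m * m)               ≡⟨ swap c m ⟩
    m * (c * m)               ≤⟨ *-monoʳ-≤ m (*-monoʳ-≤ c (*-mono-≤ α≤ β≤)) ⟩
    m * (c * (|A′| * |B′|))   ≤⟨ *-monoʳ-≤ m ih₀ ⟩
    m * (u₀ * u₀)             ∎)
    where
    swap : ∀ c m → c * (m * m) ≡ m * (c * m)
    swap = solve-∀
    α≤ = subst (_≤ |A′|) α≡ (max<-lub a N (λ _ → a≤ _))
    β≤ = subst (_≤ |B′|) β≡ (max<-lub b N (λ _ → b≤ _))

-- Counting points in a box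

InBox : ∀ {d} → ℕ → Pt d → Set
InBox N = Vec.All (_< N)

Boxed : ∀ {d} → ℕ → List (Pt d) → Set
Boxed N S = ∀ {x} → x ∈ S → InBox N x

_∈ᵇ_ : ∀ {d} → Pt d → List (Pt d) → Bool
x ∈ᵇ S = does (any? (x ≟ᵖ_) S)

∈ᵇ⁺ : ∀ {d} {x : Pt d} {S} → x ∈ S → T (x ∈ᵇ S)
∈ᵇ⁺ {x = x} {S} x∈S with any? (x ≟ᵖ_) S
... | yes _   = tt
... | no  x∉S = x∉S x∈S

∈ᵇ⁻ : ∀ {d} (x : Pt d) S → T (x ∈ᵇ S) → x ∈ S
∈ᵇ⁻ x S _ with any? (x ≟ᵖ_) S
... | yes x∈S = x∈S

∈ᵇ-mono : ∀ {d} {S S′ : List (Pt d)} → S ⊆ˢ S′ → ∀ x → T (x ∈ᵇ S) → T (x ∈ᵇ S′)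
∈ᵇ-mono {S = S} S⊆S′ x = ∈ᵇ⁺ ∘ S⊆S′ x ∘ ∈ᵇ⁻ x S

boxCount : ∀ d → ℕ → (Pt d → Bool) → ℕ
boxCount zero    N P = 𝟙 (P [])
boxCount (suc d) N P = ∑ N (λ h → boxCount d N (λ y → P (h ∷ y)))

boxCount-cong : ∀ d {N} {P Q : Pt d → Bool} → (∀ {y} → InBox N y → P y ≡ Q y) →
                boxCount d N P ≡ boxCount d N Q
boxCount-cong zero    eq = cong 𝟙 (eq Vec.[])
boxCount-cong (suc d) eq = ∑-cong _ (λ h<N → boxCount-cong d (λ y∈box → eq (h<N Vec.∷ y∈box)))

boxCount-mono : ∀ d {N} {P Q : Pt d → Bool} → (∀ y → InBox N y → T (P y) → T (Q y)) →
                boxCount d N P ≤ boxCount d N Q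
boxCount-mono zero {P = P} {Q} P⇒Q with P [] | Q [] | P⇒Q [] Vec.[]
... | false | _     | _   = z≤n
... | true  | true  | _   = ≤-refl
... | true  | false | p⇒q = ⊥-elim (p⇒q tt)
boxCount-mono (suc d) P⇒Q = ∑-mono-≤ _ (λ {h} h<N → boxCount-mono d (λ y y∈box → P⇒Q (h ∷ y) (h<N Vec.∷ y∈box)))

boxCount-insert : ∀ d {N} {x : Pt d} (P : Pt d → Bool) → InBox N x → ¬ T (P x) →
                  boxCount d N (λ y → does (y ≟ᵖ x) ∨ P y) ≡ suc (boxCount d N P)
boxCount-insert zero {x = []} P _ ¬Px with P []
... | false = refl
... | true  = ⊥-elim (¬Px tt)
boxCount-insert (suc d) {N} {h ∷ x} P (h<N Vec.∷ x∈box) ¬Px = ∑-suc-at _ h<N other here′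
  where
  other : ∀ {i} → i < N → i ≢ h →
          boxCount d N (λ y → does ((i ∷ y) ≟ᵖ (h ∷ x)) ∨ P (i ∷ y)) ≡ boxCount d N (λ y → P (i ∷ y))
  other {i} _ i≢h = boxCount-cong d (λ {y} _ → cong (λ b → b ∧ does (y ≟ᵖ x) ∨ P (i ∷ y)) (≡ᵇ-false i≢h))
  here′ : boxCount d N (λ y → does ((h ∷ y) ≟ᵖ (h ∷ x)) ∨ P (h ∷ y)) ≡ suc (boxCount d N (λ y → P (h ∷ y)))
  here′ = trans (boxCount-cong d (λ {y} _ → cong (λ b → b ∧ does (y ≟ᵖ x) ∨ P (h ∷ y)) (≡ᵇ-refl h)))
                (boxCount-insert d (λ y → P (h ∷ y)) x∈box ¬Px)

boxCount-≐ : ∀ d {N} {P Q : Pt d → Bool} → (∀ y → InBox N y → T (P y) → T (Q y)) →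
             (∀ y → InBox N y → T (Q y) → T (P y)) → boxCount d N P ≡ boxCount d N Q
boxCount-≐ d P⇒Q Q⇒P = ≤-antisym (boxCount-mono d P⇒Q) (boxCount-mono d Q⇒P)

boxCount-∅ : ∀ d {N} → boxCount d N (λ _ → false) ≡ 0
boxCount-∅ zero    = refl
boxCount-∅ (suc d) {N} = trans (∑-cong N (λ _ → boxCount-∅ d)) (∑-zero N)

length≡boxCount : ∀ {d N} {D : List (Pt d)} → Unique D → Boxed N D → length D ≡ boxCount d N (_∈ᵇ D)
length≡boxCount {d} {D = []}    []             _     = sym (boxCount-∅ d)
length≡boxCount {d} {D = x ∷ D} (x∉D ∷ unique) boxed =
  trans (cong suc (length≡boxCount unique (boxed ∘ there)))
        (sym (boxCount-insert d (_∈ᵇ D) (boxed (here refl)) (λ x∈ᵇD → List.lookup x∉D (∈ᵇ⁻ x D x∈ᵇD) refl)))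

-- Cardinalities are computed by counting membership in a box, which splits coordinate by coordinate.
card≡boxCount : ∀ {d N} {S : List (Pt d)} → Boxed N S → card S ≡ boxCount d N (_∈ᵇ S)
card≡boxCount {d} {S = S} boxed = trans
  (length≡boxCount (deduplicate-! _≟ᵖ_ S) (boxed ∘ ∈-deduplicate⁻ _≟ᵖ_ S))
  (boxCount-≐ d (λ y _ → ∈ᵇ-mono (λ _ → ∈-deduplicate⁻ _≟ᵖ_ S) y) (λ y _ → ∈ᵇ-mono {S = S} (λ _ → ∈-deduplicate⁺ _≟ᵖ_) y))

card-mono : ∀ {d N} {S S′ : List (Pt d)} → Boxed N S′ → S ⊆ˢ S′ → card S ≤ card S′
card-mono {d} {S = S} {S′} boxed S⊆S′ = begin
  card S                 ≡⟨ card≡boxCount (boxed ∘ S⊆S′ _) ⟩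
  boxCount d _ (_∈ᵇ S)   ≤⟨ boxCount-mono d (λ y _ → ∈ᵇ-mono S⊆S′ y) ⟩
  boxCount d _ (_∈ᵇ S′)  ≡⟨ card≡boxCount boxed ⟨
  card S′                ∎
  where open ≤-Reasoning

card-cong : ∀ {d N} {S S′ : List (Pt d)} → Boxed N S′ → S ⊆ˢ S′ → S′ ⊆ˢ S → card S ≡ card S′
card-cong boxed S⊆S′ S′⊆S = ≤-antisym (card-mono boxed S⊆S′) (card-mono (boxed ∘ S⊆S′ _) S′⊆S)

card-pos⇒∈ : ∀ {d} {S : List (Pt d)} → 0 < card S → ∃ λ x → x ∈ S
card-pos⇒∈ {S = x ∷ _} _ = x , here refl

-- Sumsets, fibres, shadows and projections

⊕≡cartesianProductWith : ∀ {d} (A B : List (Pt d)) → A ⊕ B ≡ cartesianProductWith (zipWith _+_) A B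
⊕≡cartesianProductWith []      B = refl
⊕≡cartesianProductWith (a ∷ A) B = cong (map (zipWith _+_ a) B ++_) (⊕≡cartesianProductWith A B)

∈-⊕⁺ : ∀ {d} {A B : List (Pt d)} {a b} → a ∈ A → b ∈ B → zipWith _+_ a b ∈ A ⊕ B
∈-⊕⁺ {A = A} {B} a∈A b∈B = subst (_ ∈_) (sym (⊕≡cartesianProductWith A B)) (∈-cartesianProductWith⁺ (zipWith _+_) a∈A b∈B)

∈-⊕⁻ : ∀ {d} (A B : List (Pt d)) {z} → z ∈ A ⊕ B → ∃₂ λ a b → a ∈ A × b ∈ B × z ≡ zipWith _+_ a b
∈-⊕⁻ A B z∈A⊕B = ∈-cartesianProductWith⁻ (zipWith _+_) A B (subst (_ ∈_) (⊕≡cartesianProductWith A B) z∈A⊕B)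

⊕-mono : ∀ {d} {A B X Y : List (Pt d)} → A ⊆ˢ X → B ⊆ˢ Y → (A ⊕ B) ⊆ˢ (X ⊕ Y)
⊕-mono {A = A} {B} A⊆X B⊆Y z z∈A⊕B with ∈-⊕⁻ A B z∈A⊕B
... | a , b , a∈A , b∈B , refl = ∈-⊕⁺ (A⊆X a a∈A) (B⊆Y b b∈B)

fiber : ∀ {d} → ℕ → List (Pt (suc d)) → List (Pt d)
fiber h S = map tail (filter (λ x → head x ≟ h) S)

shadow : ∀ {d} → List (Pt (suc d)) → List (Pt d)
shadow = map tail

∈-fiber⁻ : ∀ {d} S {h} {x : Pt d} → x ∈ fiber h S → (h ∷ x) ∈ S
∈-fiber⁻ S {h} x∈fiber with ∈-map⁻ tail x∈fiber
... | _ ∷ _ , kx∈filter , refl with ∈-filter⁻ (λ x → head x ≟ h) kx∈filter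
...   | kx∈S , refl = kx∈S

∈-shadow⁻ : ∀ {d} S {x : Pt d} → x ∈ shadow S → ∃ λ h → (h ∷ x) ∈ S
∈-shadow⁻ S x∈shadow with ∈-map⁻ tail x∈shadow
... | h ∷ _ , hx∈S , refl = h , hx∈S

module _ {d} {S : List (Pt (suc d))} where

  ∈-fiber⁺ : ∀ {h x} → (h ∷ x) ∈ S → x ∈ fiber h S
  ∈-fiber⁺ {h} hx∈S = ∈-map⁺ tail (∈-filter⁺ (λ x → head x ≟ h) hx∈S refl)

  ∈-shadow⁺ : ∀ {h x} → (h ∷ x) ∈ S → x ∈ shadow S
  ∈-shadow⁺ = ∈-map⁺ tail

  boxed-fiber : ∀ {N h} → Boxed N S → Boxed N (fiber h S)
  boxed-fiber boxed x∈fiber with boxed (∈-fiber⁻ S x∈fiber)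
  ... | _ Vec.∷ x∈box = x∈box

  boxed-shadow : ∀ {N} → Boxed N S → Boxed N (shadow S)
  boxed-shadow boxed x∈shadow with ∈-shadow⁻ S x∈shadow
  ... | _ , hx∈S with boxed hx∈S
  ...   | _ Vec.∷ x∈box = x∈box

fiber⊆shadow : ∀ {d} (S : List (Pt (suc d))) {h} → fiber h S ⊆ˢ shadow S
fiber⊆shadow S _ = ∈-shadow⁺ ∘ ∈-fiber⁻ S

module _ {d} (A B : List (Pt (suc d))) {S : List (Pt (suc d))} (A⊕B⊆S : (A ⊕ B) ⊆ˢ S) where

  fiber-⊕ : ∀ {k l} → (fiber k A ⊕ fiber l B) ⊆ˢ fiber (k + l) S
  fiber-⊕ {k} {l} _ z∈⊕ with ∈-⊕⁻ (fiber k A) (fiber l B) z∈⊕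
  ... | a , b , a∈ , b∈ , refl = ∈-fiber⁺ (A⊕B⊆S _ (∈-⊕⁺ (∈-fiber⁻ A a∈) (∈-fiber⁻ B b∈)))

  shadow-⊕ : (shadow A ⊕ shadow B) ⊆ˢ shadow S
  shadow-⊕ _ z∈⊕ with ∈-⊕⁻ (shadow A) (shadow B) z∈⊕
  ... | a , b , a∈ , b∈ , refl with ∈-shadow⁻ A a∈ | ∈-shadow⁻ B b∈
  ...   | _ , ka∈A | _ , lb∈B = ∈-shadow⁺ (A⊕B⊆S _ (∈-⊕⁺ ka∈A lb∈B))

card-fibers : ∀ {d N} {S : List (Pt (suc d))} → Boxed N S → card S ≡ ∑ N (λ h → card (fiber h S))
card-fibers {d} {N} {S} boxed = trans (card≡boxCount boxed) (∑-cong N (λ {h} _ → sym (fiberCount h)))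
  where
  fiberCount : ∀ h → card (fiber h S) ≡ boxCount d N (λ y → (h ∷ y) ∈ᵇ S)
  fiberCount h = trans (card≡boxCount (boxed-fiber boxed))
    (boxCount-≐ d (λ y _ → ∈ᵇ⁺ ∘ ∈-fiber⁻ S ∘ ∈ᵇ⁻ y (fiber h S)) (λ y _ → ∈ᵇ⁺ ∘ ∈-fiber⁺ ∘ ∈ᵇ⁻ (h ∷ y) S))

card-map-0∷ : ∀ {d N} {S : List (Pt d)} → 0 < N → Boxed N S → card (map (0 ∷_) S) ≡ card S
card-map-0∷ {d} {suc N} {S} 0<N boxed = begin
  card (map (0 ∷_) S)                                 ≡⟨ card-fibers boxed′ ⟩
  ∑ (suc N) (λ h → card (fiber h (map (0 ∷_) S)))     ≡⟨ ∑-concentrated N _ (λ {i} _ → emptyFiber i) ⟩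
  card (fiber 0 (map (0 ∷_) S))                       ≡⟨ card-cong boxed fiber₀⊆S S⊆fiber₀ ⟩
  card S                                              ∎
  where
  open ≡-Reasoning
  boxed′ : Boxed (suc N) (map (0 ∷_) S)
  boxed′ x∈ with ∈-map⁻ (0 ∷_) x∈
  ... | y , y∈S , refl = z<s Vec.∷ boxed y∈S
  fiber₀⊆S : fiber 0 (map (0 ∷_) S) ⊆ˢ S
  fiber₀⊆S x x∈ with ∈-map⁻ (0 ∷_) (∈-fiber⁻ (map (0 ∷_) S) x∈)
  ... | _ , x∈S , refl = x∈S
  S⊆fiber₀ : S ⊆ˢ fiber 0 (map (0 ∷_) S)
  S⊆fiber₀ x x∈S = ∈-fiber⁺ (∈-map⁺ (0 ∷_) x∈S)
  emptyFiber : ∀ i → 0 < i → card (fiber i (map (0 ∷_) S)) ≡ 0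
  emptyFiber (suc i) _ = n≤0⇒n≡0 (card-mono {N = suc N} {S′ = []} (λ ()) noPoint)
    where
    noPoint : fiber (suc i) (map (0 ∷_) S) ⊆ˢ []
    noPoint x x∈ with ∈-map⁻ (0 ∷_) (∈-fiber⁻ (map (0 ∷_) S) x∈)
    ... | _ , _ , ()

π-full : ∀ {d} (x : Pt d) → π (fullIdx d) x ≡ x
π-full []      = refl
π-full (k ∷ x) = cong (k ∷_) (π-full x)

πˢ-full : ∀ {d} (S : List (Pt d)) → πˢ (fullIdx d) S ≡ S
πˢ-full S = trans (map-cong π-full S) (map-id S)

π-inBox : ∀ {d N} (I : IdxSet d) {x : Pt d} → 0 < N → InBox N x → InBox N (π I x)
π-inBox []          _   Vec.[]             = Vec.[]
π-inBox (true ∷ I)  0<N (k<N Vec.∷ x∈box) = k<N Vec.∷ π-inBox I 0<N x∈box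
π-inBox (false ∷ I) 0<N (_   Vec.∷ x∈box) = 0<N Vec.∷ π-inBox I 0<N x∈box

boxed-πˢ : ∀ {d N} (I : IdxSet d) {S : List (Pt d)} → 0 < N → Boxed N S → Boxed N (πˢ I S)
boxed-πˢ I 0<N boxed y∈ with ∈-map⁻ (π I) y∈
... | _ , x∈S , refl = π-inBox I 0<N (boxed x∈S)

πˢ-mono : ∀ {d} (I : IdxSet d) {S S′ : List (Pt d)} → S ⊆ˢ S′ → πˢ I S ⊆ˢ πˢ I S′
πˢ-mono I S⊆S′ _ y∈ with ∈-map⁻ (π I) y∈
... | x , x∈S , refl = ∈-map⁺ (π I) (S⊆S′ x x∈S)

module _ {d N} (I : IdxSet d) {S : List (Pt (suc d))} (0<N : 0 < N) (boxed : Boxed N S) where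

  card-πˢ-true : card (πˢ (true ∷ I) S) ≡ ∑ N (λ h → card (πˢ I (fiber h S)))
  card-πˢ-true = trans (card-fibers (boxed-πˢ (true ∷ I) 0<N boxed))
                       (∑-cong N (λ _ → card-cong (boxed-πˢ I 0<N (boxed-fiber boxed)) to from))
    where
    to : ∀ {h} → fiber h (πˢ (true ∷ I) S) ⊆ˢ πˢ I (fiber h S)
    to y y∈ with ∈-map⁻ (π (true ∷ I)) (∈-fiber⁻ (πˢ (true ∷ I) S) y∈)
    ... | _ ∷ x , hx∈S , refl = ∈-map⁺ (π I) (∈-fiber⁺ hx∈S)
    from : ∀ {h} → πˢ I (fiber h S) ⊆ˢ fiber h (πˢ (true ∷ I) S)
    from y y∈ with ∈-map⁻ (π I) y∈
    ... | x , x∈fiber , refl = ∈-fiber⁺ (∈-map⁺ (π (true ∷ I)) (∈-fiber⁻ S x∈fiber))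

  card-πˢ-false : card (πˢ (false ∷ I) S) ≡ card (πˢ I (shadow S))
  card-πˢ-false = trans (card-cong boxed₀ to from) (card-map-0∷ 0<N (boxed-πˢ I 0<N (boxed-shadow boxed)))
    where
    boxed₀ : Boxed N (map (0 ∷_) (πˢ I (shadow S)))
    boxed₀ y∈ with ∈-map⁻ (0 ∷_) y∈
    ... | _ , z∈ , refl = 0<N Vec.∷ boxed-πˢ I 0<N (boxed-shadow boxed) z∈
    to : πˢ (false ∷ I) S ⊆ˢ map (0 ∷_) (πˢ I (shadow S))
    to y y∈ with ∈-map⁻ (π (false ∷ I)) y∈
    ... | _ ∷ x , kx∈S , refl = ∈-map⁺ (0 ∷_) (∈-map⁺ (π I) (∈-shadow⁺ kx∈S))
    from : map (0 ∷_) (πˢ I (shadow S)) ⊆ˢ πˢ (false ∷ I) S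
    from y y∈ with ∈-map⁻ (0 ∷_) y∈
    ... | z , z∈ , refl with ∈-map⁻ (π I) z∈
    ...   | x , x∈shadow , refl with ∈-shadow⁻ S x∈shadow
    ...     | _ , kx∈S = ∈-map⁺ (π (false ∷ I)) kx∈S

sum-map-∑ : ∀ {A : Set} n (F : A → ℕ → ℕ) (L : List A) →
            sum (map (λ a → ∑ n (F a)) L) ≡ ∑ n (λ i → sum (map (λ a → F a i) L))
sum-map-∑ n F []      = sym (∑-zero n)
sum-map-∑ n F (a ∷ L) = trans (cong (∑ n (F a) +_) (sum-map-∑ n F L)) (sym (∑-distrib-+ n))

sum-map-mono : ∀ {A : Set} {f g : A → ℕ} (L : List A) → (∀ a → f a ≤ g a) → sum (map f L) ≤ sum (map g L)
sum-map-mono []      f≤g = z≤n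
sum-map-mono (a ∷ L) f≤g = +-mono-≤ (f≤g a) (sum-map-mono L f≤g)

sum-map-++-map : ∀ {A B : Set} {g h : A → B} (f : B → ℕ) (xs ys : List A) →
                 sum (map f (map g xs ++ map h ys)) ≡ sum (map (f ∘ g) xs) + sum (map (f ∘ h) ys)
sum-map-++-map {g = g} {h} f xs ys = begin
  sum (map f (map g xs ++ map h ys))                  ≡⟨ cong sum (map-++ f (map g xs) (map h ys)) ⟩
  sum (map f (map g xs) ++ map f (map h ys))          ≡⟨ sum-++ (map f (map g xs)) _ ⟩
  sum (map f (map g xs)) + sum (map f (map h ys))     ≡⟨ cong₂ (λ as bs → sum as + sum bs) (map-∘ xs) (map-∘ ys) ⟨
  sum (map (f ∘ g) xs) + sum (map (f ∘ h) ys)         ∎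
  where open ≡-Reasoning

-- The recursive form of Σ_{I ⊆ [d]} |π_I S|: index sets without the first coordinate see the
-- shadow of S, those containing it see its fibres.
projCount : ∀ d → ℕ → List (Pt d) → ℕ
projCount zero    N S = card S
projCount (suc d) N S = projCount d N (shadow S) + ∑ N (λ h → projCount d N (fiber h S))

sum-card-πˢ≡projCount : ∀ d {N} {S : List (Pt d)} → 0 < N → Boxed N S →
                         sum (map (λ I → card (πˢ I S)) (allIdxSets d)) ≡ projCount d N S
sum-card-πˢ≡projCount zero    {S = S} _ _ = trans (+-identityʳ _) (cong card (πˢ-full S))
sum-card-πˢ≡projCount (suc d) {N} {S} 0<N boxed = begin
  sum (map f (map (true ∷_) 𝓘 ++ map (false ∷_) 𝓘))
    ≡⟨ sum-map-++-map f 𝓘 𝓘 ⟩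
  sum (map (f ∘ (true ∷_)) 𝓘) + sum (map (f ∘ (false ∷_)) 𝓘)
    ≡⟨ cong₂ (λ as bs → sum as + sum bs) (map-cong (λ I → card-πˢ-true I 0<N boxed) 𝓘)
                                         (map-cong (λ I → card-πˢ-false I 0<N boxed) 𝓘) ⟩
  sum (map (λ I → ∑ N (λ h → card (πˢ I (fiber h S)))) 𝓘) + sum (map (λ I → card (πˢ I (shadow S))) 𝓘)
    ≡⟨ cong₂ _+_ (sum-map-∑ N (λ I h → card (πˢ I (fiber h S))) 𝓘)
                 (sum-card-πˢ≡projCount d 0<N (boxed-shadow boxed)) ⟩
  ∑ N (λ h → sum (map (λ I → card (πˢ I (fiber h S))) 𝓘)) + projCount d N (shadow S)
    ≡⟨ cong (_+ projCount d N (shadow S)) (∑-cong N (λ _ → sum-card-πˢ≡projCount d 0<N (boxed-fiber boxed))) ⟩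
  ∑ N (λ h → projCount d N (fiber h S)) + projCount d N (shadow S)
    ≡⟨ +-comm _ (projCount d N (shadow S)) ⟩
  projCount (suc d) N S ∎
  where
  open ≡-Reasoning
  𝓘 = allIdxSets d
  f : IdxSet (suc d) → ℕ
  f I = card (πˢ I S)

module _ {d : ℕ} where

  filter-true∷ : ∀ (𝓘 : List (IdxSet d)) →
    filter (λ I → ¬? (≡-dec Data.Bool._≟_ I (fullIdx (suc d)))) (map (true ∷_) 𝓘) ≡
    map (true ∷_) (filter (λ I → ¬? (≡-dec Data.Bool._≟_ I (fullIdx d))) 𝓘)
  filter-true∷ []      = refl
  filter-true∷ (I ∷ 𝓘) with does (≡-dec Data.Bool._≟_ I (fullIdx d))
  ... | true  = filter-true∷ 𝓘
  ... | false = cong ((true ∷ I) ∷_) (filter-true∷ 𝓘)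

  filter-false∷ : ∀ (𝓘 : List (IdxSet d)) →
    filter (λ I → ¬? (≡-dec Data.Bool._≟_ I (fullIdx (suc d)))) (map (false ∷_) 𝓘) ≡ map (false ∷_) 𝓘
  filter-false∷ []      = refl
  filter-false∷ (I ∷ 𝓘) = cong ((false ∷ I) ∷_) (filter-false∷ 𝓘)

properIdxSets-suc : ∀ d → properIdxSets (suc d) ≡ map (true ∷_) (properIdxSets d) ++ map (false ∷_) (allIdxSets d)
properIdxSets-suc d = trans (filter-++ _ (map (true ∷_) (allIdxSets d)) (map (false ∷_) (allIdxSets d)))
                            (cong₂ _++_ (filter-true∷ (allIdxSets d)) (filter-false∷ (allIdxSets d)))

sum-allIdxSets : ∀ d (f : IdxSet d → ℕ) → sum (map f (allIdxSets d)) ≡ f (fullIdx d) + sum (map f (properIdxSets d))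
sum-allIdxSets zero    f = refl
sum-allIdxSets (suc d) f = begin
  sum (map f (map (true ∷_) 𝓘 ++ map (false ∷_) 𝓘))                     ≡⟨ sum-map-++-map f 𝓘 𝓘 ⟩
  sum (map (f ∘ (true ∷_)) 𝓘) + sum (map (f ∘ (false ∷_)) 𝓘)            ≡⟨ cong (_+ sum (map (f ∘ (false ∷_)) 𝓘)) (sum-allIdxSets d (f ∘ (true ∷_))) ⟩
  f (fullIdx (suc d)) + sum (map (f ∘ (true ∷_)) (properIdxSets d)) + sum (map (f ∘ (false ∷_)) 𝓘)
                                                                         ≡⟨ +-assoc (f (fullIdx (suc d))) _ _ ⟩
  f (fullIdx (suc d)) + (sum (map (f ∘ (true ∷_)) (properIdxSets d)) + sum (map (f ∘ (false ∷_)) 𝓘))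
                                                                         ≡⟨ cong (f (fullIdx (suc d)) +_) (sum-map-++-map f (properIdxSets d) 𝓘) ⟨
  f (fullIdx (suc d)) + sum (map f (map (true ∷_) (properIdxSets d) ++ map (false ∷_) 𝓘))
                                                                         ≡⟨ cong (λ 𝓙 → f (fullIdx (suc d)) + sum (map f 𝓙)) (properIdxSets-suc d) ⟨
  f (fullIdx (suc d)) + sum (map f (properIdxSets (suc d)))             ∎
  where
  open ≡-Reasoning
  𝓘 = allIdxSets d

projCount-lowerBound : ∀ d N (A B S : List (Pt d)) → Boxed N A → Boxed N B → Boxed N S → (A ⊕ B) ⊆ˢ S →
                       4 ^ d * (card A * card B) ≤ projCount d N S * projCount d N S
projCount-lowerBound zero N [] B S _ _ _ _ = z≤n
projCount-lowerBound zero N A@(_ ∷ _) [] S _ _ _ _ rewrite *-zeroʳ (card A) = z≤n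
projCount-lowerBound zero N A@([] ∷ _) B@([] ∷ _) S _ _ boxedS A⊕B⊆S =
  subst (_≤ card S * card S) (sym (*-identityˡ _)) (*-mono-≤ (card-mono boxedS A⊆S) (card-mono boxedS B⊆S))
  where
  A⊆S : A ⊆ˢ S
  A⊆S [] a∈A = A⊕B⊆S [] (∈-⊕⁺ a∈A (here refl))
  B⊆S : B ⊆ˢ S
  B⊆S [] b∈B = A⊕B⊆S [] (∈-⊕⁺ {A = A} (here refl) b∈B)
projCount-lowerBound (suc d) N A B S boxedA boxedB boxedS A⊕B⊆S =
  subst₂ (λ |A| |B| → 4 * 4 ^ d * (|A| * |B|) ≤ projCount (suc d) N S * projCount (suc d) N S)
    (sym (card-fibers boxedA)) (sym (card-fibers boxedB))
    (inductionStep (4 ^ d) N (λ k → card (fiber k A)) (λ l → card (fiber l B)) (λ h → projCount d N (fiber h S))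
      (card (shadow A)) (card (shadow B)) (projCount d N (shadow S))
      (λ k → card-mono (boxed-shadow boxedA) (fiber⊆shadow A))
      (λ l → card-mono (boxed-shadow boxedB) (fiber⊆shadow B))
      (projCount-lowerBound d N _ _ _ (boxed-shadow boxedA) (boxed-shadow boxedB) (boxed-shadow boxedS)
        (shadow-⊕ A B A⊕B⊆S))
      (λ k l → projCount-lowerBound d N _ _ _ (boxed-fiber boxedA) (boxed-fiber boxedB) (boxed-fiber boxedS)
        (fiber-⊕ A B A⊕B⊆S))
      support)
  where
  support : ∀ {k l} → k < N → l < N → 0 < card (fiber k A) → 0 < card (fiber l B) → k + l < N
  support _ _ 0<|Aₖ| 0<|Bₗ| with card-pos⇒∈ 0<|Aₖ| | card-pos⇒∈ 0<|Bₗ|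
  ... | _ , a∈ | _ , b∈ with boxedS (A⊕B⊆S _ (∈-⊕⁺ (∈-fiber⁻ A a∈) (∈-fiber⁻ B b∈)))
  ...   | k+l<N Vec.∷ _ = k+l<N

coordBound : ∀ {d} → List (Pt d) → ℕ
coordBound S = suc (sum (map Vec.sum S))

boxed-coordBound : ∀ {d} (S : List (Pt d)) → Boxed (coordBound S) S
boxed-coordBound S x∈S = sum<⇒inBox _ (s≤s (∈⇒sum≤ S x∈S))
  where
  sum<⇒inBox : ∀ {d n} (x : Pt d) → Vec.sum x < n → InBox n x
  sum<⇒inBox []      _      = Vec.[]
  sum<⇒inBox (k ∷ x) sum<n = <-≤-trans (s≤s (m≤m+n k (Vec.sum x))) sum<n Vec.∷
                              sum<⇒inBox x (<-≤-trans (s≤s (m≤n+m (Vec.sum x) k)) sum<n)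
  ∈⇒sum≤ : ∀ {d} (S : List (Pt d)) {x} → x ∈ S → Vec.sum x ≤ sum (map Vec.sum S)
  ∈⇒sum≤ (y ∷ S) (here refl) = m≤m+n (Vec.sum y) _
  ∈⇒sum≤ (y ∷ S) (there x∈S) = ≤-trans (∈⇒sum≤ S x∈S) (m≤n+m _ (Vec.sum y))

projCount≡card+projSum : ∀ d {N} {S : List (Pt d)} → 0 < N → Boxed N S → projCount d N S ≡ card S + projSum d S
projCount≡card+projSum d {N} {S} 0<N boxed = begin
  projCount d N S                                               ≡⟨ sum-card-πˢ≡projCount d 0<N boxed ⟨
  sum (map (λ I → card (πˢ I S)) (allIdxSets d))                ≡⟨ sum-allIdxSets d (λ I → card (πˢ I S)) ⟩
  card (πˢ (fullIdx d) S) + projSum d S                         ≡⟨ cong (λ S′ → card S′ + projSum d S) (πˢ-full S) ⟩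
  card S + projSum d S                                          ∎
  where open ≡-Reasoning

projSum-mono : ∀ d {N} {S S′ : List (Pt d)} → 0 < N → Boxed N S′ → S ⊆ˢ S′ → projSum d S ≤ projSum d S′
projSum-mono d 0<N boxed S⊆S′ =
  sum-map-mono (properIdxSets d) (λ I → card-mono (boxed-πˢ I 0<N boxed) (πˢ-mono I S⊆S′))

2^d*min≤projCount : ∀ d {N} {A B : List (Pt d)} → Boxed N A → Boxed N B → Boxed N (A ⊕ B) →
                    2 ^ d * (card A ⊓ card B) ≤ projCount d N (A ⊕ B)
2^d*min≤projCount d {N} {A} {B} boxedA boxedB boxedA⊕B = square-≤⇒≤ (begin
  2 ^ d * μ * (2 ^ d * μ)        ≡⟨ regroup (2 ^ d) μ ⟩
  2 ^ d * 2 ^ d * (μ * μ)        ≡⟨ cong (_* (μ * μ)) (4^n≡2^n*2^n d) ⟨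
  4 ^ d * (μ * μ)                ≤⟨ *-monoʳ-≤ (4 ^ d) (*-mono-≤ (m⊓n≤m (card A) (card B)) (m⊓n≤n (card A) (card B))) ⟩
  4 ^ d * (card A * card B)      ≤⟨ projCount-lowerBound d N A B (A ⊕ B) boxedA boxedB boxedA⊕B (λ _ → id) ⟩
  projCount d N (A ⊕ B) * projCount d N (A ⊕ B) ∎)
  where
  open ≤-Reasoning
  μ = card A ⊓ card B
  regroup : ∀ t m → t * m * (t * m) ≡ t * t * (m * m)
  regroup = solve-∀

sumset-bound : ∀ d (X Y A B : List (Pt d)) → A ⊆ˢ X → B ⊆ˢ Y →
               2 ^ d * (card A ⊓ card B) ≤ card (A ⊕ B) + projSum d (X ⊕ Y)
sumset-bound d X Y A B A⊆X B⊆Y = begin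
  2 ^ d * (card A ⊓ card B)          ≤⟨ 2^d*min≤projCount d boxedA boxedB boxedA⊕B ⟩
  projCount d N (A ⊕ B)              ≡⟨ projCount≡card+projSum d z<s boxedA⊕B ⟩
  card (A ⊕ B) + projSum d (A ⊕ B)   ≤⟨ +-monoʳ-≤ (card (A ⊕ B)) (projSum-mono d z<s boxedZ A⊕B⊆Z) ⟩
  card (A ⊕ B) + projSum d (X ⊕ Y)   ∎
  where
  open ≤-Reasoning
  Z = X ⊕ Y
  N = coordBound (A ++ B ++ Z)
  boxedA : Boxed N A
  boxedA = boxed-coordBound (A ++ B ++ Z) ∘ ∈-++⁺ˡ
  boxedB : Boxed N B
  boxedB = boxed-coordBound (A ++ B ++ Z) ∘ ∈-++⁺ʳ A ∘ ∈-++⁺ˡ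
  boxedZ : Boxed N Z
  boxedZ = boxed-coordBound (A ++ B ++ Z) ∘ ∈-++⁺ʳ A ∘ ∈-++⁺ʳ B
  A⊕B⊆Z : (A ⊕ B) ⊆ˢ Z
  A⊕B⊆Z = ⊕-mono A⊆X B⊆Y
  boxedA⊕B : Boxed N (A ⊕ B)
  boxedA⊕B = boxedZ ∘ A⊕B⊆Z _

open import Data.Integer as ℤ using (ℤ; +_; _-_; _≥_; _⊖_)
import Data.Integer.Properties as ℤ

+m-+o≤+n : ∀ {m n o} → m ≤ n + o → + m - + o ℤ.≤ + n
+m-+o≤+n {m} {n} {o} m≤n+o = begin
  + m - + o        ≡⟨ ℤ.[+m]-[+n]≡m⊖n m o ⟩
  m ⊖ o            ≤⟨ ℤ.⊖-monoˡ-≤ o m≤n+o ⟩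
  (n + o) ⊖ o      ≡⟨ ℤ.⊖-≥ (m≤n+m o n) ⟩
  + (n + o ∸ o)    ≡⟨ cong +_ (m+n∸n≡m n o) ⟩
  + n              ∎
  where open ℤ.≤-Reasoning

lemma2p8 : (d : ℕ) (X Y A B : List (Pt d)) →
    IsDownSet X → IsDownSet Y → A ⊆ˢ X → B ⊆ˢ Y →
    + card (A ⊕ B) ≥ (+ (2 ^ d * (card A ⊓ card B))) - (+ projSum d (X ⊕ Y))
lemma2p8 d X Y A B _ _ A⊆X B⊆Y = +m-+o≤+n (sumset-bound d X Y A B A⊆X B⊆Y)
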